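{- For $n\ge 1$ let $F_n$ be the friendship graph. In the Strings-and-Coins game on $F_n$ with optimal play: if $n$ is odd, Player 2 wins by exactly three points; if $n$ is even, Player 1 wins by exactly one point.
   Context: Strings-and-Coins game: played on a finite multigraph (loops and parallel edges allowed) in which every vertex initially has at least one incident edge. Two players, Player 1 moving first, alternately remove one edge. Whenever a removal leaves one or more vertices with no incident edges, the mover earns one point for each such vertex and must move again, provided edges remain. The game ends when no edges remain; a player wins if they have more points, and it is a tie if scores are equal. Optimal play means each player maximizes (own final score) minus (opponent's final score). "Player X wins by $m$ points" means that under optimal play the final score of X exceeds the opponent's by exactly $m$. The friendship graph $F_n$ consists of $n$ copies of the triangle $K_3$ that share a single common vertex and are otherwise disjoint (so it has $2n+1$ vertices and $3n$ edges). -}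

module Defs where

open import Data.Nat using (ℕ; zero; suc; _+_; _*_; _≟_)
open import Data.Integer using (ℤ; +_; _-_; -_; _⊔_)
open import Data.Product using (_×_; _,_; proj₁; proj₂)
open import Data.Bool using (Bool; true; false; if_then_else_; not; _∨_)
open import Data.Fin using (Fin; zero; suc)
open import Data.Vec using (Vec; []; _∷_; removeAt; _++_)
open import Relation.Nullary.Decidable using (⌊_⌋)

-- A finite multigraph is given by its edge list; vertices are natural
-- numbers, an edge is an (unordered) pair of endpoints; a loop is (a , a);
-- parallel edges are repeated entries.  The vertex set is the set of
-- endpoints (every vertex has an incident edge, as in the game setup).
Edge : Set
Edge = ℕ × ℕ

incident : ∀ {m} → ℕ → Vec Edge m → Bool
incident v [] = false
incident v ((a , b) ∷ es) = ⌊ v ≟ a ⌋ ∨ ⌊ v ≟ b ⌋ ∨ incident v es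

isolatedPt : ∀ {m} → ℕ → Vec Edge m → ℤ
isolatedPt v es = if incident v es then + 0 else + 1

-- points earned by removing edge (a , b), leaving the edges `rest`:
-- the number of endpoints of the removed edge left with no incident edge
-- (a loop has a single endpoint).
gain : ∀ {m} → Edge → Vec Edge m → ℤ
gain (a , b) rest =
  if ⌊ a ≟ b ⌋ then isolatedPt a rest
  else isolatedPt a rest Data.Integer.+ isolatedPt b rest

maxFin : ∀ {m} → (Fin (suc m) → ℤ) → ℤ
maxFin {zero} f = f zero
maxFin {suc m} f = f zero ⊔ maxFin (λ i → f (suc i))

-- value of a position under optimal play, from the point of view of the
-- player about to move: (mover's final score from now on) minus
-- (opponent's final score from now on).  If the move earns points the
-- same player moves again, otherwise the turn passes.
value : ∀ {m} → Vec Edge m → ℤ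
value [] = + 0
value {suc m} es = maxFin (λ i → moveValue (Data.Vec.lookup es i) (removeAt es i))
  where
  moveValue : Edge → Vec Edge m → ℤ
  moveValue e rest =
    if ⌊ gain e rest Data.Integer.≟ + 0 ⌋
    then - value rest
    else gain e rest Data.Integer.+ value rest

-- the friendship graph F_n: centre 0, triangle i (i < n) on vertices
-- 0, 2i+1, 2i+2.  It has 3n edges.
triangles : (n : ℕ) → Vec Edge (n * 3)
triangles zero = []
triangles (suc n) =
  (0 , 2 * n + 1) ∷ (0 , 2 * n + 2) ∷ (2 * n + 1 , 2 * n + 2) ∷ triangles n

friendship : (n : ℕ) → Vec Edge (n * 3)
friendship = triangles

{-# OPTIONS --safe #-}

-- A position reachable from F_n is a list of pieces, one per triangle: the full triangle or what is left
-- of it (a cherry: both spokes; a chain: one spoke and the rim; a leaf: one spoke; a dimer: the rim alone;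
-- nothing).  Let t, c, l, d count full triangles, chains, leaves and dimers.  For the player to move the
-- position is worth  2c + l + 2d + δ,  where
--   δ = 1 if t = 0 and the centre still has an edge,  0 if t = 0 otherwise,  1 if t > 0 is even,
--   δ = -1 if t is odd and c > 0,  δ = -3 if t is odd and c = 0.
-- Every removal changes (t, c, l, d) in one of six ways and scores a number of points that depends only on
-- whether the centre becomes isolated, so checking the formula against the recursion defining the value is a
-- finite computation over (kind of move, t zero / odd / even, c = 0?, l = 0?).  No move beats the formula,
-- and it is attained by taking dimers, then leaves, then chain ends (but a lone chain is cut at the centre
-- when t is odd), and opening a triangle at its rim only when nothing else is left.  On F_n we have t = n
-- and c = l = d = 0.

module Submission where

open import Defs
open import Data.Nat using (ℕ; _+_; _*_)
open import Data.Integer using (ℤ; +_; -[1+_])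
open import Data.Product using (_×_)
open import Relation.Binary.PropositionalEquality using (_≡_)

open import Data.Bool using (Bool; true; false; if_then_else_; _∨_)
open import Data.Bool.Properties using (∨-zeroʳ)
open import Data.Empty using (⊥-elim)
open import Data.Fin using (Fin; zero; suc; _↑ʳ_)
import Data.Integer as ℤ
import Data.Integer.Properties as ℤ
open import Data.Nat using (zero; suc; _≤_; _<_; z≤n; s≤s; _≤?_; _≟_)
import Data.Nat.Properties as ℕ
open import Algebra.Properties.CommutativeSemigroup ℕ.+-commutativeSemigroup using (x∙yz≈y∙xz)
open import Data.Nat.Tactic.RingSolver using (solve-∀)
open import Data.Product using (Σ; ∃; _,_)
open import Data.Sum using (_⊎_; inj₁; inj₂)
open import Data.Vec using (Vec; []; _∷_; _++_; lookup; removeAt; replicate)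
open import Data.Vec.Relation.Unary.Any using (Any; here; there)
open import Data.Vec.Relation.Unary.Any.Properties using (++⁺ˡ)
open import Function using (_∘_)
open import Relation.Binary.PropositionalEquality
  using (_≢_; ≢-sym; refl; sym; trans; cong; cong₂; subst; subst₂; module ≡-Reasoning)
open import Relation.Nullary using (Dec; ¬_; yes; no)
open import Relation.Nullary.Decidable using (⌊_⌋; isYes≗does; dec-true; dec-false; from-yes; map′; _×-dec_)

private
  variable
    m n : ℕ

≟-refl : ∀ v → ⌊ v ≟ v ⌋ ≡ true
≟-refl v = trans (isYes≗does (v ≟ v)) (dec-true (v ≟ v) refl)

≟-≢ : ∀ {v w} → v ≢ w → ⌊ v ≟ w ⌋ ≡ false
≟-≢ {v} {w} v≢w = trans (isYes≗does (v ≟ w)) (dec-false (v ≟ w) v≢w)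

Endpoint : ℕ → Edge → Set
Endpoint v (a , b) = v ≡ a ⊎ v ≡ b

endpoint⇒incident : ∀ {v} {es : Vec Edge m} → Any (Endpoint v) es → incident v es ≡ true
endpoint⇒incident {v = v} {es = (_ , b) ∷ es} (here (inj₁ refl)) =
  cong (_∨ ⌊ v ≟ b ⌋ ∨ incident v es) (≟-refl v)
endpoint⇒incident {v = v} {es = (a , _) ∷ es} (here (inj₂ refl)) =
  trans (cong (λ x → ⌊ v ≟ a ⌋ ∨ x ∨ incident v es) (≟-refl v)) (∨-zeroʳ ⌊ v ≟ a ⌋)
endpoint⇒incident {v = v} {es = (a , b) ∷ _} (there p) =
  trans (cong (λ x → ⌊ v ≟ a ⌋ ∨ ⌊ v ≟ b ⌋ ∨ x) (endpoint⇒incident p))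
        (trans (cong (⌊ v ≟ a ⌋ ∨_) (∨-zeroʳ ⌊ v ≟ b ⌋)) (∨-zeroʳ ⌊ v ≟ a ⌋))

incident-skip : ∀ {v a b} (es : Vec Edge m) → v ≢ a → v ≢ b → incident v ((a , b) ∷ es) ≡ incident v es
incident-skip {v = v} es v≢a v≢b = cong₂ (λ x y → x ∨ y ∨ incident v es) (≟-≢ v≢a) (≟-≢ v≢b)

-- Positions as lists of pieces

X Y : ℕ → ℕ
X n = 2 * n + 1
Y n = 2 * n + 2

2n<X : ∀ n → 2 * n < X n
2n<X n = ℕ.m<m+n (2 * n) (s≤s z≤n)

X<Y : ∀ n → X n < Y n
X<Y n = ℕ.+-monoʳ-< (2 * n) (s≤s (s≤s z≤n))

Y≡2[1+n] : ∀ n → Y n ≡ 2 * suc n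
Y≡2[1+n] n = trans (ℕ.+-comm (2 * n) 2) (sym (ℕ.*-suc 2 n))

record Outer (n v : ℕ) : Set where
  constructor outer
  field
    positive : 1 ≤ v
    bounded : v ≤ 2 * n

record NotOnTriangle (n v : ℕ) : Set where
  constructor notOn
  field
    ≢0 : v ≢ 0
    ≢X : v ≢ X n
    ≢Y : v ≢ Y n

outer-lift : ∀ {v} → Outer n v → Outer (suc n) v
outer-lift {n} (outer 1≤v v≤2n) = outer 1≤v (ℕ.≤-trans v≤2n (ℕ.*-monoʳ-≤ 2 (ℕ.n≤1+n n)))

outerX : ∀ n → Outer (suc n) (X n)
outerX n = outer (ℕ.m≤n+m 1 (2 * n)) (ℕ.<⇒≤ (ℕ.<-≤-trans (X<Y n) (ℕ.≤-reflexive (Y≡2[1+n] n))))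

outerY : ∀ n → Outer (suc n) (Y n)
outerY n = outer (ℕ.≤-trans (Outer.positive (outerX n)) (ℕ.<⇒≤ (X<Y n))) (ℕ.≤-reflexive (Y≡2[1+n] n))

outer-notOn : ∀ {v} → Outer n v → NotOnTriangle n v
outer-notOn {n} (outer 1≤v v≤2n) =
  notOn (ℕ.>⇒≢ 1≤v) (ℕ.<⇒≢ (ℕ.≤-<-trans v≤2n (2n<X n)))
        (ℕ.<⇒≢ (ℕ.≤-<-trans v≤2n (ℕ.<-trans (2n<X n) (X<Y n))))

beyond-notOn : ∀ {v} → 2 * suc n < v → NotOnTriangle n v
beyond-notOn {n} {v} 2[1+n]<v =
  notOn (ℕ.>⇒≢ (ℕ.≤-<-trans z≤n 2[1+n]<v)) (ℕ.>⇒≢ (ℕ.<-trans (X<Y n) Y<v)) (ℕ.>⇒≢ Y<v)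
  where
  Y<v : Y n < v
  Y<v = ℕ.≤-<-trans (ℕ.≤-reflexive (Y≡2[1+n] n)) 2[1+n]<v

-- The remains of triangle i after some removals; chainX keeps the spoke to X, leafX only that spoke.
data Piece : Set where
  full cherry chainX chainY leafX leafY dimer empty : Piece

record Census : Set where
  constructor census
  field
    t c l d : ℕ
open Census

infixr 5 _⊕_
_⊕_ : Census → Census → Census
census t c l d ⊕ census t′ c′ l′ d′ = census (t + t′) (c + c′) (l + l′) (d + d′)

⊕-cancelˡ : ∀ a {b b′} → a ⊕ b ≡ a ⊕ b′ → b ≡ b′
⊕-cancelˡ (census t c l d) {census _ _ _ _} {census _ _ _ _} eq
  with refl ← ℕ.+-cancelˡ-≡ t _ _ (cong Census.t eq)
     | refl ← ℕ.+-cancelˡ-≡ c _ _ (cong Census.c eq)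
     | refl ← ℕ.+-cancelˡ-≡ l _ _ (cong Census.l eq)
     | refl ← ℕ.+-cancelˡ-≡ d _ _ (cong Census.d eq) = refl

⊕-swap : ∀ a b c → a ⊕ (b ⊕ c) ≡ b ⊕ (a ⊕ c)
⊕-swap (census t₁ c₁ l₁ d₁) (census t₂ c₂ l₂ d₂) (census t₃ c₃ l₃ d₃)
  rewrite x∙yz≈y∙xz t₁ t₂ t₃ | x∙yz≈y∙xz c₁ c₂ c₃
        | x∙yz≈y∙xz l₁ l₂ l₃ | x∙yz≈y∙xz d₁ d₂ d₃ = refl

contents : Piece → Census
contents full = census 1 0 0 0
contents cherry = census 0 0 2 0
contents chainX = census 0 1 0 0
contents chainY = census 0 1 0 0
contents leafX = census 0 0 1 0
contents leafY = census 0 0 1 0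
contents dimer = census 0 0 0 1
contents empty = census 0 0 0 0

edgeCount : Census → ℕ
edgeCount a = 3 * t a + 2 * c a + l a + d a

size : Piece → ℕ
size τ = edgeCount (contents τ)

block : ℕ → (τ : Piece) → Vec Edge (size τ)
block n full = (0 , X n) ∷ (0 , Y n) ∷ (X n , Y n) ∷ []
block n cherry = (0 , X n) ∷ (0 , Y n) ∷ []
block n chainX = (0 , X n) ∷ (X n , Y n) ∷ []
block n chainY = (0 , Y n) ∷ (X n , Y n) ∷ []
block n leafX = (0 , X n) ∷ []
block n leafY = (0 , Y n) ∷ []
block n dimer = (X n , Y n) ∷ []
block n empty = []

-- As in `triangles`, the head piece belongs to the triangle with the largest index.
data Represents : Vec Edge m → Vec Piece n → Set where
  [] : Represents [] []
  _∷_ : ∀ {es : Vec Edge m} {σ : Vec Piece n} τ → Represents es σ → Represents (block n τ ++ es) (τ ∷ σ)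

tally : Vec Piece n → Census
tally [] = census 0 0 0 0
tally (τ ∷ σ) = contents τ ⊕ tally σ

edgeCount-⊕ : ∀ a b → edgeCount (a ⊕ b) ≡ edgeCount a + edgeCount b
edgeCount-⊕ (census t c l d) (census t′ c′ l′ d′) = linear t c l d t′ c′ l′ d′
  where
  linear : ∀ t c l d t′ c′ l′ d′ →
           3 * (t + t′) + 2 * (c + c′) + (l + l′) + (d + d′)
             ≡ (3 * t + 2 * c + l + d) + (3 * t′ + 2 * c′ + l′ + d′)
  linear = solve-∀

length≡edgeCount : ∀ {es : Vec Edge m} {σ : Vec Piece n} → Represents es σ → m ≡ edgeCount (tally σ)
length≡edgeCount [] = refl
length≡edgeCount {σ = τ ∷ σ} (τ ∷ r) =
  trans (cong (λ k → size τ + k) (length≡edgeCount r)) (sym (edgeCount-⊕ (contents τ) (tally σ)))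

edgeCount≡0 : ∀ a → edgeCount a ≡ 0 → a ≡ census 0 0 0 0
edgeCount≡0 (census zero zero zero zero) _ = refl
edgeCount≡0 (census (suc _) _ _ _) ()
edgeCount≡0 (census zero (suc _) _ _) ()
edgeCount≡0 (census zero zero (suc _) _) ()
edgeCount≡0 (census zero zero zero (suc _)) ()

block-skip : ∀ {v} n τ (es : Vec Edge m) → NotOnTriangle n v → incident v (block n τ ++ es) ≡ incident v es
block-skip n full es (notOn v≢0 v≢X v≢Y) rewrite ≟-≢ v≢0 | ≟-≢ v≢X | ≟-≢ v≢Y = refl
block-skip n cherry es (notOn v≢0 v≢X v≢Y) rewrite ≟-≢ v≢0 | ≟-≢ v≢X | ≟-≢ v≢Y = refl
block-skip n chainX es (notOn v≢0 v≢X v≢Y) rewrite ≟-≢ v≢0 | ≟-≢ v≢X | ≟-≢ v≢Y = refl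
block-skip n chainY es (notOn v≢0 v≢X v≢Y) rewrite ≟-≢ v≢0 | ≟-≢ v≢X | ≟-≢ v≢Y = refl
block-skip n leafX es (notOn v≢0 v≢X _) rewrite ≟-≢ v≢0 | ≟-≢ v≢X = refl
block-skip n leafY es (notOn v≢0 _ v≢Y) rewrite ≟-≢ v≢0 | ≟-≢ v≢Y = refl
block-skip n dimer es (notOn _ v≢X v≢Y) rewrite ≟-≢ v≢X | ≟-≢ v≢Y = refl
block-skip n empty es _ = refl

isolated-beyond : ∀ {v} {es : Vec Edge m} {σ : Vec Piece n} →
                  Represents es σ → 2 * n < v → incident v es ≡ false
isolated-beyond [] _ = refl
isolated-beyond {n = suc n} (τ ∷ r) 2[1+n]<v =
  trans (block-skip n τ _ (beyond-notOn 2[1+n]<v))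
        (isolated-beyond r (ℕ.≤-<-trans (ℕ.*-monoʳ-≤ 2 (ℕ.n≤1+n n)) 2[1+n]<v))

-- Moves

data Kind : Set where
  openSpoke openRim takeLeaf cutChain takeEnd takeDimer : Kind

pre post : Kind → Census
pre openSpoke = census 1 0 0 0
pre openRim = census 1 0 0 0
pre takeLeaf = census 0 0 1 0
pre cutChain = census 0 1 0 0
pre takeEnd = census 0 1 0 0
pre takeDimer = census 0 0 0 1
post openSpoke = census 0 1 0 0
post openRim = census 0 0 2 0
post takeLeaf = census 0 0 0 0
post cutChain = census 0 0 0 1
post takeEnd = census 0 0 1 0
post takeDimer = census 0 0 0 0

point : Bool → ℤ
point stillIncident = if stillIncident then + 0 else + 1

-- What a move of kind k scores, given the point z for the centre.
points : Kind → ℤ → ℤ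
points openSpoke z = z ℤ.+ + 0
points cutChain z = z ℤ.+ + 0
points takeLeaf z = z ℤ.+ + 1
points openRim _ = + 0
points takeEnd _ = + 1
points takeDimer _ = + 2

-- The Boolean indices say whether the outer endpoints of the removed edge still have an edge.
data SpokeKind : Kind → Bool → Set where
  openSpoke : SpokeKind openSpoke true
  cutChain : SpokeKind cutChain true
  takeLeaf : SpokeKind takeLeaf false

data RimKind : Kind → Bool → Bool → Set where
  openRim : RimKind openRim true true
  takeEndˣ : RimKind takeEnd false true
  takeEndʸ : RimKind takeEnd true false
  takeDimer : RimKind takeDimer false false

data Shape (n : ℕ) (rest : Vec Edge m) : Kind → Edge → Set where
  spoke : ∀ {k v b} → Outer n v → incident v rest ≡ b → SpokeKind k b → Shape n rest k (0 , v)
  rim : ∀ {k x y bx by} → Outer n x → Outer n y → x ≢ y →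
        incident x rest ≡ bx → incident y rest ≡ by → RimKind k bx by → Shape n rest k (x , y)

shape-lift : ∀ {k e} {rest : Vec Edge m} τ → Shape n rest k e → Shape (suc n) (block n τ ++ rest) k e
shape-lift {n = n} {rest = rest} τ (spoke o eq s) =
  spoke (outer-lift o) (trans (block-skip n τ rest (outer-notOn o)) eq) s
shape-lift {n = n} {rest = rest} τ (rim ox oy x≢y eqx eqy s) =
  rim (outer-lift ox) (outer-lift oy) x≢y
      (trans (block-skip n τ rest (outer-notOn ox)) eqx) (trans (block-skip n τ rest (outer-notOn oy)) eqy) s

spoke-points : ∀ {k b} → SpokeKind k b → ∀ z → z ℤ.+ point b ≡ points k z
spoke-points openSpoke _ = refl
spoke-points cutChain _ = refl
spoke-points takeLeaf _ = refl

rim-points : ∀ {k bx by} → RimKind k bx by → ∀ z → point bx ℤ.+ point by ≡ points k z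
rim-points openRim _ = refl
rim-points takeEndˣ _ = refl
rim-points takeEndʸ _ = refl
rim-points takeDimer _ = refl

gain-shape : ∀ {k e} {rest : Vec Edge m} → Shape n rest k e → gain e rest ≡ points k (point (incident 0 rest))
gain-shape (spoke {v = zero} (outer () _) _ _)
gain-shape {rest = rest} (spoke {v = suc _} _ eq s) =
  trans (cong (λ b → point (incident 0 rest) ℤ.+ point b) eq) (spoke-points s _)
gain-shape (rim _ _ x≢y eqx eqy s) rewrite ≟-≢ x≢y =
  trans (cong₂ (λ bx by → point bx ℤ.+ point by) eqx eqy) (rim-points s _)

record Transition (σ : Vec Piece n) (e : Edge) (rest : Vec Edge m) : Set where
  constructor transition
  field
    {σ′} : Vec Piece n
    represents : Represents rest σ′
    kind : Kind
    others : Census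
    tally-before : tally σ ≡ pre kind ⊕ others
    tally-after : tally σ′ ≡ post kind ⊕ others
    shape : Shape n rest kind e

transition-lift : ∀ {σ : Vec Piece n} {e} {rest : Vec Edge m} τ →
                  Transition σ e rest → Transition (τ ∷ σ) e (block n τ ++ rest)
transition-lift τ (transition r k b before after sh) =
  transition (τ ∷ r) k (contents τ ⊕ b)
    (trans (cong (contents τ ⊕_) before) (⊕-swap (contents τ) (pre k) b))
    (trans (cong (contents τ ⊕_) after) (⊕-swap (contents τ) (post k) b))
    (shape-lift τ sh)

Removal : Vec Piece n → (es : Vec Edge m) → Fin m → Set
Removal {m = suc m} σ es i = Transition σ (lookup es i) (removeAt es i)

module _ {es : Vec Edge m} {σ : Vec Piece n} (r : Represents es σ) where

  incident-block : ∀ {v} τ → Any (Endpoint v) (block n τ) → incident v (block n τ ++ es) ≡ true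
  incident-block τ p = endpoint⇒incident (++⁺ˡ p)

  X-isolated : incident (X n) es ≡ false
  X-isolated = isolated-beyond r (2n<X n)

  Y-isolated : incident (Y n) es ≡ false
  Y-isolated = isolated-beyond r (ℕ.<-trans (2n<X n) (X<Y n))

  X-isolated-beside-leafY : incident (X n) (block n leafY ++ es) ≡ false
  X-isolated-beside-leafY =
    trans (incident-skip es (NotOnTriangle.≢0 (outer-notOn (outerX n))) (ℕ.<⇒≢ (X<Y n))) X-isolated

  Y-isolated-beside-leafX : incident (Y n) (block n leafX ++ es) ≡ false
  Y-isolated-beside-leafX =
    trans (incident-skip es (NotOnTriangle.≢0 (outer-notOn (outerY n))) (ℕ.>⇒≢ (X<Y n))) Y-isolated

removal : ∀ {es : Vec Edge m} {σ : Vec Piece n} → Represents es σ → (i : Fin m) → Removal σ es i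
removal {n = suc n} (full ∷ r) zero =
  transition (chainY ∷ r) openSpoke _ refl refl
    (spoke (outerX n) (incident-block r chainY (there (here (inj₁ refl)))) openSpoke)
removal {n = suc n} (full ∷ r) (suc zero) =
  transition (chainX ∷ r) openSpoke _ refl refl
    (spoke (outerY n) (incident-block r chainX (there (here (inj₂ refl)))) openSpoke)
removal {n = suc n} (full ∷ r) (suc (suc zero)) =
  transition (cherry ∷ r) openRim _ refl refl
    (rim (outerX n) (outerY n) (ℕ.<⇒≢ (X<Y n))
         (incident-block r cherry (here (inj₂ refl))) (incident-block r cherry (there (here (inj₂ refl)))) openRim)
removal {n = suc n} (cherry ∷ r) zero =
  transition (leafY ∷ r) takeLeaf _ refl refl (spoke (outerX n) (X-isolated-beside-leafY r) takeLeaf)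
removal {n = suc n} (cherry ∷ r) (suc zero) =
  transition (leafX ∷ r) takeLeaf _ refl refl (spoke (outerY n) (Y-isolated-beside-leafX r) takeLeaf)
removal {n = suc n} (chainX ∷ r) zero =
  transition (dimer ∷ r) cutChain _ refl refl
    (spoke (outerX n) (incident-block r dimer (here (inj₁ refl))) cutChain)
removal {n = suc n} (chainX ∷ r) (suc zero) =
  transition (leafX ∷ r) takeEnd _ refl refl
    (rim (outerX n) (outerY n) (ℕ.<⇒≢ (X<Y n))
         (incident-block r leafX (here (inj₂ refl))) (Y-isolated-beside-leafX r) takeEndʸ)
removal {n = suc n} (chainY ∷ r) zero =
  transition (dimer ∷ r) cutChain _ refl refl
    (spoke (outerY n) (incident-block r dimer (here (inj₂ refl))) cutChain)
removal {n = suc n} (chainY ∷ r) (suc zero) =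
  transition (leafY ∷ r) takeEnd _ refl refl
    (rim (outerX n) (outerY n) (ℕ.<⇒≢ (X<Y n))
         (X-isolated-beside-leafY r) (incident-block r leafY (here (inj₂ refl))) takeEndˣ)
removal {n = suc n} (leafX ∷ r) zero =
  transition (empty ∷ r) takeLeaf _ refl refl (spoke (outerX n) (X-isolated r) takeLeaf)
removal {n = suc n} (leafY ∷ r) zero =
  transition (empty ∷ r) takeLeaf _ refl refl (spoke (outerY n) (Y-isolated r) takeLeaf)
removal {n = suc n} (dimer ∷ r) zero =
  transition (empty ∷ r) takeDimer _ refl refl
    (rim (outerX n) (outerY n) (ℕ.<⇒≢ (X<Y n)) (X-isolated r) (Y-isolated r) takeDimer)
removal (_∷_ {es = []} full r) (suc (suc (suc ())))
removal (_∷_ {es = _ ∷ _} full r) (suc (suc (suc i))) = transition-lift full (removal r i)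
removal (_∷_ {es = []} cherry r) (suc (suc ()))
removal (_∷_ {es = _ ∷ _} cherry r) (suc (suc i)) = transition-lift cherry (removal r i)
removal (_∷_ {es = []} chainX r) (suc (suc ()))
removal (_∷_ {es = _ ∷ _} chainX r) (suc (suc i)) = transition-lift chainX (removal r i)
removal (_∷_ {es = []} chainY r) (suc (suc ()))
removal (_∷_ {es = _ ∷ _} chainY r) (suc (suc i)) = transition-lift chainY (removal r i)
removal (_∷_ {es = []} leafX r) (suc ())
removal (_∷_ {es = _ ∷ _} leafX r) (suc i) = transition-lift leafX (removal r i)
removal (_∷_ {es = []} leafY r) (suc ())
removal (_∷_ {es = _ ∷ _} leafY r) (suc i) = transition-lift leafY (removal r i)
removal (_∷_ {es = []} dimer r) (suc ())
removal (_∷_ {es = _ ∷ _} dimer r) (suc i) = transition-lift dimer (removal r i)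
removal (_∷_ {es = _ ∷ _} empty r) i = transition-lift empty (removal r i)

kindOf : ∀ {es : Vec Edge m} {σ : Vec Piece n} → Represents es σ → Fin m → Kind
kindOf {m = suc m} r i = Transition.kind (removal r i)

kindOf-↑ʳ : ∀ {es : Vec Edge m} {σ : Vec Piece n} τ (r : Represents es σ) i →
            kindOf (τ ∷ r) (size τ ↑ʳ i) ≡ kindOf r i
kindOf-↑ʳ {es = []} τ r ()
kindOf-↑ʳ {es = _ ∷ _} full r i = refl
kindOf-↑ʳ {es = _ ∷ _} cherry r i = refl
kindOf-↑ʳ {es = _ ∷ _} chainX r i = refl
kindOf-↑ʳ {es = _ ∷ _} chainY r i = refl
kindOf-↑ʳ {es = _ ∷ _} leafX r i = refl
kindOf-↑ʳ {es = _ ∷ _} leafY r i = refl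
kindOf-↑ʳ {es = _ ∷ _} dimer r i = refl
kindOf-↑ʳ {es = _ ∷ _} empty r i = refl

supply : Kind → Census → ℕ
supply openSpoke = t
supply openRim = t
supply takeLeaf = l
supply cutChain = c
supply takeEnd = c
supply takeDimer = d

supply-⊕ : ∀ k a b → supply k (a ⊕ b) ≡ supply k a + supply k b
supply-⊕ openSpoke _ _ = refl
supply-⊕ openRim _ _ = refl
supply-⊕ takeLeaf _ _ = refl
supply-⊕ cutChain _ _ = refl
supply-⊕ takeEnd _ _ = refl
supply-⊕ takeDimer _ _ = refl

supply-pre : ∀ k b → 1 ≤ supply k (pre k ⊕ b)
supply-pre openSpoke _ = s≤s z≤n
supply-pre openRim _ = s≤s z≤n
supply-pre takeLeaf _ = s≤s z≤n
supply-pre cutChain _ = s≤s z≤n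
supply-pre takeEnd _ = s≤s z≤n
supply-pre takeDimer _ = s≤s z≤n

localMove : ∀ {es : Vec Edge m} {σ : Vec Piece n} τ (r : Represents es σ) k →
            1 ≤ supply k (contents τ) → ∃ λ i → kindOf (τ ∷ r) i ≡ k
localMove full r = λ
  { openSpoke _ → zero , refl ; openRim _ → suc (suc zero) , refl
  ; takeLeaf () ; cutChain () ; takeEnd () ; takeDimer () }
localMove cherry r = λ
  { takeLeaf _ → zero , refl
  ; openSpoke () ; openRim () ; cutChain () ; takeEnd () ; takeDimer () }
localMove chainX r = λ
  { cutChain _ → zero , refl ; takeEnd _ → suc zero , refl
  ; openSpoke () ; openRim () ; takeLeaf () ; takeDimer () }
localMove chainY r = λ
  { cutChain _ → zero , refl ; takeEnd _ → suc zero , refl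
  ; openSpoke () ; openRim () ; takeLeaf () ; takeDimer () }
localMove leafX r = λ
  { takeLeaf _ → zero , refl
  ; openSpoke () ; openRim () ; cutChain () ; takeEnd () ; takeDimer () }
localMove leafY r = λ
  { takeLeaf _ → zero , refl
  ; openSpoke () ; openRim () ; cutChain () ; takeEnd () ; takeDimer () }
localMove dimer r = λ
  { takeDimer _ → zero , refl
  ; openSpoke () ; openRim () ; takeLeaf () ; cutChain () ; takeEnd () }
localMove empty r = λ
  { openSpoke () ; openRim () ; takeLeaf () ; cutChain () ; takeEnd () ; takeDimer () }

findMove : ∀ {es : Vec Edge m} {σ : Vec Piece n} (r : Represents es σ) k →
           1 ≤ supply k (tally σ) → ∃ λ i → kindOf r i ≡ k
findMove [] = λ
  { openSpoke () ; openRim () ; takeLeaf () ; cutChain () ; takeEnd () ; takeDimer () }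
findMove {σ = τ ∷ σ} (τ ∷ r) k p with 1 ≤? supply k (tally σ)
... | yes q = let i , eq = findMove r k q in size τ ↑ʳ i , trans (kindOf-↑ʳ τ r i) eq
... | no q = localMove τ r k (positive-left (subst (1 ≤_) (supply-⊕ k (contents τ) (tally σ)) p) q)
  where
  positive-left : ∀ {x y} → 1 ≤ x + y → ¬ 1 ≤ y → 1 ≤ x
  positive-left {x} {zero} 1≤x+0 _ = subst (1 ≤_) (ℕ.+-identityʳ x) 1≤x+0
  positive-left {y = suc _} _ 1≰y = ⊥-elim (1≰y (s≤s z≤n))

-- The value formula

data Triangles : Set where
  none odd even : Triangles

oneMore : Triangles → Triangles
oneMore none = odd
oneMore odd = even
oneMore even = odd

triangleClass : ℕ → Triangles
triangleClass zero = none
triangleClass (suc n) = oneMore (triangleClass n)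

occupied : ℕ → Bool
occupied zero = false
occupied (suc _) = true

record Class : Set where
  constructor ⟨_,_,_⟩
  field
    fullClass : Triangles
    anyChain anyLeaf : Bool
open Class

classOf : Census → Class
classOf a = ⟨ triangleClass (t a) , occupied (c a) , occupied (l a) ⟩

alive : Class → Bool
alive ⟨ none , anyChain , anyLeaf ⟩ = anyChain ∨ anyLeaf
alive ⟨ odd , _ , _ ⟩ = true
alive ⟨ even , _ , _ ⟩ = true

alive-oneMore : ∀ p ch lv → alive ⟨ oneMore p , ch , lv ⟩ ≡ true
alive-oneMore none _ _ = refl
alive-oneMore odd _ _ = refl
alive-oneMore even _ _ = refl

alive-chain : ∀ p lv → alive ⟨ p , true , lv ⟩ ≡ true
alive-chain none _ = refl
alive-chain odd _ = refl
alive-chain even _ = refl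

alive-leaf : ∀ p ch → alive ⟨ p , ch , true ⟩ ≡ true
alive-leaf none ch = ∨-zeroʳ ch
alive-leaf odd _ = refl
alive-leaf even _ = refl

centre-incident : ∀ {es : Vec Edge m} {σ : Vec Piece n} →
                  Represents es σ → incident 0 es ≡ alive (classOf (tally σ))
centre-incident [] = refl
centre-incident {σ = _ ∷ σ} (full ∷ r) = sym (alive-oneMore (triangleClass (t (tally σ))) _ _)
centre-incident {σ = _ ∷ σ} (cherry ∷ r) = sym (alive-leaf (triangleClass (t (tally σ))) _)
centre-incident {σ = _ ∷ σ} (chainX ∷ r) = sym (alive-chain (triangleClass (t (tally σ))) _)
centre-incident {σ = _ ∷ σ} (chainY ∷ r) = sym (alive-chain (triangleClass (t (tally σ))) _)
centre-incident {σ = _ ∷ σ} (leafX ∷ r) = sym (alive-leaf (triangleClass (t (tally σ))) _)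
centre-incident {σ = _ ∷ σ} (leafY ∷ r) = sym (alive-leaf (triangleClass (t (tally σ))) _)
centre-incident {n = suc n} (_∷_ {es = es} dimer r) =
  trans (incident-skip es (≢-sym (NotOnTriangle.≢0 (outer-notOn (outerX n))))
                          (≢-sym (NotOnTriangle.≢0 (outer-notOn (outerY n)))))
        (centre-incident r)
centre-incident (empty ∷ r) = centre-incident r

preClass postClass : Kind → Class → Class
preClass openSpoke ⟨ p , ch , lv ⟩ = ⟨ oneMore p , ch , lv ⟩
preClass openRim ⟨ p , ch , lv ⟩ = ⟨ oneMore p , ch , lv ⟩
preClass takeLeaf ⟨ p , ch , _ ⟩ = ⟨ p , ch , true ⟩
preClass cutChain ⟨ p , _ , lv ⟩ = ⟨ p , true , lv ⟩
preClass takeEnd ⟨ p , _ , lv ⟩ = ⟨ p , true , lv ⟩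
preClass takeDimer x = x
postClass openSpoke ⟨ p , _ , lv ⟩ = ⟨ p , true , lv ⟩
postClass openRim ⟨ p , ch , _ ⟩ = ⟨ p , ch , true ⟩
postClass takeLeaf x = x
postClass cutChain x = x
postClass takeEnd ⟨ p , ch , _ ⟩ = ⟨ p , ch , true ⟩
postClass takeDimer x = x

classOf-pre : ∀ k b → classOf (pre k ⊕ b) ≡ preClass k (classOf b)
classOf-pre openSpoke _ = refl
classOf-pre openRim _ = refl
classOf-pre takeLeaf _ = refl
classOf-pre cutChain _ = refl
classOf-pre takeEnd _ = refl
classOf-pre takeDimer _ = refl

classOf-post : ∀ k b → classOf (post k ⊕ b) ≡ postClass k (classOf b)
classOf-post openSpoke _ = refl
classOf-post openRim _ = refl
classOf-post takeLeaf _ = refl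
classOf-post cutChain _ = refl
classOf-post takeEnd _ = refl
classOf-post takeDimer _ = refl

surplus : Class → ℤ
surplus ⟨ none , false , false ⟩ = + 0
surplus ⟨ none , _ , _ ⟩ = + 1
surplus ⟨ odd , false , _ ⟩ = -[1+ 2 ]
surplus ⟨ odd , true , _ ⟩ = -[1+ 0 ]
surplus ⟨ even , _ , _ ⟩ = + 1

loose : Census → ℕ
loose a = 2 * c a + l a + 2 * d a

worth : Census → ℤ
worth a = surplus (classOf a) ℤ.+ + loose a

-- This is the local moveValue of `value`, so `value (e ∷ es)` unfolds to a maxFin of afterScoring terms.
afterScoring : ℤ → ℤ → ℤ
afterScoring g v = if ⌊ g ℤ.≟ + 0 ⌋ then ℤ.- v else g ℤ.+ v

afterScoring-shift-≤ : ∀ g {u w} X →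
                       afterScoring g u ℤ.≤ w → afterScoring g (u ℤ.+ + X) ℤ.≤ w ℤ.+ + X
afterScoring-shift-≤ g {u} X with ⌊ g ℤ.≟ + 0 ⌋
... | true = λ h → ℤ.≤-trans (ℤ.≤-reflexive (ℤ.neg-distrib-+ u (+ X))) (ℤ.+-mono-≤ h ℤ.neg-≤-pos)
... | false = λ h → ℤ.≤-trans (ℤ.≤-reflexive (sym (ℤ.+-assoc g u (+ X)))) (ℤ.+-monoˡ-≤ (+ X) h)

afterScoring-shift-≡ : ∀ g {u w} X → ⌊ g ℤ.≟ + 0 ⌋ ≡ false ⊎ X ≡ 0 →
                       afterScoring g u ≡ w → afterScoring g (u ℤ.+ + X) ≡ w ℤ.+ + X
afterScoring-shift-≡ g {u} {w} X (inj₂ refl) h =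
  trans (cong (afterScoring g) (ℤ.+-identityʳ u)) (trans h (sym (ℤ.+-identityʳ w)))
afterScoring-shift-≡ g {u} X (inj₁ scores) with ⌊ g ℤ.≟ + 0 ⌋
... | false = λ h → trans (sym (ℤ.+-assoc g u (+ X))) (cong (ℤ._+ + X) h)
... | true with () ← scores

loose-⊕ : ∀ a b → loose (a ⊕ b) ≡ loose a + loose b
loose-⊕ (census _ c l d) (census _ c′ l′ d′) = linear c l d c′ l′ d′
  where
  linear : ∀ c l d c′ l′ d′ →
           2 * (c + c′) + (l + l′) + 2 * (d + d′) ≡ (2 * c + l + 2 * d) + (2 * c′ + l′ + 2 * d′)
  linear = solve-∀

worth-⊕ : ∀ a b → worth (a ⊕ b) ≡ (surplus (classOf (a ⊕ b)) ℤ.+ + loose a) ℤ.+ + loose b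
worth-⊕ a b = trans (cong (λ n → surplus (classOf (a ⊕ b)) ℤ.+ + n) (loose-⊕ a b))
                    (sym (ℤ.+-assoc (surplus (classOf (a ⊕ b))) (+ loose a) (+ loose b)))

moveWorth : Kind → Census → ℤ
moveWorth k b = afterScoring (points k (point (alive (classOf (post k ⊕ b))))) (worth (post k ⊕ b))

classGain : Kind → Class → ℤ
classGain k x = points k (point (alive (postClass k x)))

classMove classWorth : Kind → Class → ℤ
classMove k x = afterScoring (classGain k x) (surplus (postClass k x) ℤ.+ + loose (post k))
classWorth k x = surplus (preClass k x) ℤ.+ + loose (pre k)

moveWorth-shift : ∀ k b → moveWorth k b ≡
  afterScoring (classGain k (classOf b)) ((surplus (postClass k (classOf b)) ℤ.+ + loose (post k)) ℤ.+ + loose b)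
moveWorth-shift k b =
  trans (cong (afterScoring (points k (point (alive (classOf (post k ⊕ b)))))) (worth-⊕ (post k) b))
        (cong (λ x → afterScoring (points k (point (alive x))) ((surplus x ℤ.+ + loose (post k)) ℤ.+ + loose b))
              (classOf-post k b))

worth-pre-shift : ∀ k b → worth (pre k ⊕ b) ≡ classWorth k (classOf b) ℤ.+ + loose b
worth-pre-shift k b =
  trans (worth-⊕ (pre k) b) (cong (λ x → (surplus x ℤ.+ + loose (pre k)) ℤ.+ + loose b) (classOf-pre k b))

∀-Bool? : {P : Bool → Set} → (∀ b → Dec (P b)) → Dec (∀ b → P b)
∀-Bool? p = map′ (λ (f , t) → λ { false → f ; true → t }) (λ h → h false , h true)
                 (p false ×-dec p true)

∀-Triangles? : {P : Triangles → Set} → (∀ p → Dec (P p)) → Dec (∀ p → P p)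
∀-Triangles? p =
  map′ (λ (n , o , e) → λ { none → n ; odd → o ; even → e }) (λ h → h none , h odd , h even)
       (p none ×-dec p odd ×-dec p even)

∀-Class? : {P : Class → Set} → (∀ x → Dec (P x)) → Dec (∀ x → P x)
∀-Class? P? =
  map′ (λ h x → h (fullClass x) (anyChain x) (anyLeaf x)) (λ h p ch lv → h ⟨ p , ch , lv ⟩)
       (∀-Triangles? λ p → ∀-Bool? λ ch → ∀-Bool? λ lv → P? ⟨ p , ch , lv ⟩)

∀-Kind? : {P : Kind → Set} → (∀ k → Dec (P k)) → Dec (∀ k → P k)
∀-Kind? p =
  map′ (λ (a , b , c , d , e , f) → λ
         { openSpoke → a ; openRim → b ; takeLeaf → c ; cutChain → d ; takeEnd → e ; takeDimer → f })
       (λ h → h openSpoke , h openRim , h takeLeaf , h cutChain , h takeEnd , h takeDimer)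
       (p openSpoke ×-dec p openRim ×-dec p takeLeaf ×-dec p cutChain ×-dec p takeEnd ×-dec p takeDimer)

-- 6 × 12 closed inequalities, decided by evaluation.
classMove-≤ : ∀ k x → classMove k x ℤ.≤ classWorth k x
classMove-≤ = from-yes (∀-Kind? λ k → ∀-Class? λ x → classMove k x ℤ.≤? classWorth k x)

moveWorth-≤ : ∀ k b → moveWorth k b ℤ.≤ worth (pre k ⊕ b)
moveWorth-≤ k b =
  subst₂ ℤ._≤_ (sym (moveWorth-shift k b)) (sym (worth-pre-shift k b))
         (afterScoring-shift-≤ (classGain k (classOf b)) (loose b) (classMove-≤ k (classOf b)))

-- A move that passes the turn hands the loose points to the opponent, hence the second alternative.
moveWorth-≡ : ∀ k b → ⌊ classGain k (classOf b) ℤ.≟ + 0 ⌋ ≡ false ⊎ loose b ≡ 0 →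
              classMove k (classOf b) ≡ classWorth k (classOf b) → moveWorth k b ≡ worth (pre k ⊕ b)
moveWorth-≡ k b scores-or-bare eq =
  trans (moveWorth-shift k b)
        (trans (afterScoring-shift-≡ (classGain k (classOf b)) (loose b) scores-or-bare eq)
               (sym (worth-pre-shift k b)))

takeDimer-optimal : ∀ x → classMove takeDimer x ≡ classWorth takeDimer x
takeDimer-optimal = from-yes (∀-Class? λ x → classMove takeDimer x ℤ.≟ classWorth takeDimer x)

takeLeaf-optimal : ∀ x → classMove takeLeaf x ≡ classWorth takeLeaf x
takeLeaf-optimal = from-yes (∀-Class? λ x → classMove takeLeaf x ℤ.≟ classWorth takeLeaf x)

takeEnd-optimal : ∀ p → classMove takeEnd ⟨ p , true , false ⟩ ≡ classWorth takeEnd ⟨ p , true , false ⟩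
takeEnd-optimal none = refl
takeEnd-optimal odd = refl
takeEnd-optimal even = refl

lastChain-optimal : ∀ p → Σ Kind λ k → pre k ≡ pre takeEnd ×
                          classMove k ⟨ p , false , false ⟩ ≡ classWorth k ⟨ p , false , false ⟩
lastChain-optimal none = takeEnd , refl , refl
lastChain-optimal odd = cutChain , refl , refl
lastChain-optimal even = takeEnd , refl , refl

openRim-optimal : ∀ p → classMove openRim ⟨ p , false , false ⟩ ≡ classWorth openRim ⟨ p , false , false ⟩
openRim-optimal none = refl
openRim-optimal odd = refl
openRim-optimal even = refl

point+1-scores : ∀ b → ⌊ point b ℤ.+ + 1 ℤ.≟ + 0 ⌋ ≡ false
point+1-scores false = refl
point+1-scores true = refl

Optimal : Census → Set
Optimal a = Σ Kind λ k → Σ Census λ b → a ≡ pre k ⊕ b × moveWorth k b ≡ worth (pre k ⊕ b)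

optimal : ∀ a → a ≢ census 0 0 0 0 → Optimal a
optimal (census t c l (suc d)) _ =
  takeDimer , census t c l d , refl ,
  moveWorth-≡ takeDimer (census t c l d) (inj₁ refl) (takeDimer-optimal (classOf (census t c l d)))
optimal (census t c (suc l) zero) _ =
  takeLeaf , census t c l 0 , refl ,
  moveWorth-≡ takeLeaf (census t c l 0) (inj₁ (point+1-scores (alive (classOf (census t c l 0)))))
              (takeLeaf-optimal (classOf (census t c l 0)))
optimal (census t (suc (suc c)) zero zero) _ =
  takeEnd , census t (suc c) 0 0 , refl ,
  moveWorth-≡ takeEnd (census t (suc c) 0 0) (inj₁ refl) (takeEnd-optimal (triangleClass t))
optimal (census t (suc zero) zero zero) _ =
  let k , same , opt = lastChain-optimal (triangleClass t)
  in k , census t 0 0 0 , cong (_⊕ census t 0 0 0) (sym same) , moveWorth-≡ k (census t 0 0 0) (inj₂ refl) opt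
optimal (census (suc t) zero zero zero) _ =
  openRim , census t 0 0 0 , refl ,
  moveWorth-≡ openRim (census t 0 0 0) (inj₂ refl) (openRim-optimal (triangleClass t))
optimal (census zero zero zero zero) nonempty = ⊥-elim (nonempty refl)

maxFin-lub : ∀ {f : Fin (suc m) → ℤ} {v} → (∀ i → f i ℤ.≤ v) → maxFin f ℤ.≤ v
maxFin-lub {zero} f≤v = f≤v zero
maxFin-lub {suc m} f≤v = ℤ.⊔-lub (f≤v zero) (maxFin-lub (f≤v ∘ suc))

maxFin-attained : ∀ {f : Fin (suc m) → ℤ} {v} →
                  (∀ i → f i ℤ.≤ v) → ∃ (λ i → f i ≡ v) → maxFin f ≡ v
maxFin-attained {zero} _ (zero , fi≡v) = fi≡v
maxFin-attained {suc m} {f} f≤v (zero , f0≡v) =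
  trans (ℤ.i≥j⇒i⊔j≡i (subst (maxFin (f ∘ suc) ℤ.≤_) (sym f0≡v) (maxFin-lub (f≤v ∘ suc)))) f0≡v
maxFin-attained {suc m} {f} f≤v (suc i , fi≡v) =
  trans (cong (f zero ℤ.⊔_) (maxFin-attained (f≤v ∘ suc) (i , fi≡v))) (ℤ.i≤j⇒i⊔j≡j (f≤v zero))

module _ {σ : Vec Piece n} {e : Edge} {rest : Vec Edge m} (tr : Transition σ e rest) where
  open Transition tr

  transition-value : value rest ≡ worth (tally σ′) →
                     afterScoring (gain e rest) (value rest) ≡ moveWorth kind others
  transition-value value≡worth = cong₂ afterScoring gain≡ (trans value≡worth (cong worth tally-after))
    where
    gain≡ : gain e rest ≡ points kind (point (alive (classOf (post kind ⊕ others))))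
    gain≡ = trans (gain-shape shape)
                  (cong (points kind ∘ point)
                        (trans (centre-incident represents) (cong (alive ∘ classOf) tally-after)))

  transition-optimal : value rest ≡ worth (tally σ′) → ∀ {k b} → kind ≡ k → tally σ ≡ pre k ⊕ b →
                       moveWorth k b ≡ worth (pre k ⊕ b) →
                       afterScoring (gain e rest) (value rest) ≡ worth (tally σ)
  transition-optimal value≡worth {b = b} refl split optimal = begin
    afterScoring (gain e rest) (value rest) ≡⟨ transition-value value≡worth ⟩
    moveWorth kind others                   ≡⟨ cong (moveWorth kind) others≡b ⟩
    moveWorth kind b                        ≡⟨ optimal ⟩
    worth (pre kind ⊕ b)                    ≡⟨ cong worth (sym split) ⟩
    worth (tally σ)                         ∎
    where
    open ≡-Reasoning
    others≡b : others ≡ b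
    others≡b = ⊕-cancelˡ (pre kind) (trans (sym tally-before) split)

value-represented : ∀ {es : Vec Edge m} {σ : Vec Piece n} → Represents es σ → value es ≡ worth (tally σ)
value-represented {es = []} {σ} r = cong worth (sym (edgeCount≡0 (tally σ) (sym (length≡edgeCount r))))
value-represented {m = suc m} {es = es@(_ ∷ _)} {σ} r = maxFin-attained bounded attained
  where
  move : Fin (suc m) → ℤ
  move i = afterScoring (gain (lookup es i) (removeAt es i)) (value (removeAt es i))

  after : ∀ i → value (removeAt es i) ≡ worth (tally (Transition.σ′ (removal r i)))
  after i = value-represented (Transition.represents (removal r i))

  bounded : ∀ i → move i ℤ.≤ worth (tally σ)
  bounded i = subst₂ ℤ._≤_ (sym (transition-value tr (after i))) (cong worth (sym (Transition.tally-before tr)))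
                     (moveWorth-≤ (Transition.kind tr) (Transition.others tr))
    where
    tr : Removal σ es i
    tr = removal r i

  attained : ∃ λ i → move i ≡ worth (tally σ)
  attained =
    let k , b , split , opt = optimal (tally σ) nonempty
        i , kind≡k = findMove r k (subst (λ a → 1 ≤ supply k a) (sym split) (supply-pre k b))
    in i , transition-optimal (removal r i) (after i) kind≡k split opt
    where
    nonempty : tally σ ≢ census 0 0 0 0
    nonempty tally≡0 = ℕ.1+n≢0 (trans (length≡edgeCount r) (cong edgeCount tally≡0))

initial : ∀ n → Represents (friendship n) (replicate n full)
initial zero = []
initial (suc n) = full ∷ initial n

tally-initial : ∀ n → tally (replicate n full) ≡ census n 0 0 0
tally-initial zero = refl
tally-initial (suc n) = cong (contents full ⊕_) (tally-initial n)

value-friendship : ∀ n → value (friendship n) ≡ surplus ⟨ triangleClass n , false , false ⟩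
value-friendship n = trans (value-represented (initial n)) (trans (cong worth (tally-initial n)) (ℤ.+-identityʳ _))

triangleClass-odd : ∀ k → triangleClass (2 * k + 1) ≡ odd
triangleClass-odd zero = refl
triangleClass-odd (suc k) = trans (cong triangleClass (two-more k)) (cong (oneMore ∘ oneMore) (triangleClass-odd k))
  where
  two-more : ∀ k → 2 * suc k + 1 ≡ suc (suc (2 * k + 1))
  two-more = solve-∀

triangleClass-even : ∀ k → triangleClass (2 * k + 2) ≡ even
triangleClass-even k rewrite ℕ.+-suc (2 * k) 1 | triangleClass-odd k = refl

theorem1 : (k : ℕ) →
    (value (friendship (2 * k + 1)) ≡ -[1+ 2 ]) × (value (friendship (2 * k + 2)) ≡ + 1)
theorem1 k =
  trans (value-friendship (2 * k + 1)) (cong (λ p → surplus ⟨ p , false , false ⟩) (triangleClass-odd k)) ,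
  trans (value-friendship (2 * k + 2)) (cong (λ p → surplus ⟨ p , false , false ⟩) (triangleClass-even k))
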